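{- Let $x<y$ be coprime nonnegative integers, and let the even continued fraction expansion of $\frac{x}{y}$ be $[0;a_1,a_2,\ldots,a_{2n-1}]$. For coprime nonnegative integers $u, v$, we have $\begin{pmatrix} u\\ v\end{pmatrix}\in\Psi_2\begin{pmatrix} x\\ y\end{pmatrix}$ if and only if the even continued fraction of $\frac{u}{v}$ has the form \[ \frac{u}{v}= [4b_0;4b_1, 4b_2, \ldots, 4b_{2m}, 4b_{2m+1} + a_1, a_2, \ldots, a_{2n-1}], \] where the $b_i$ are nonnegative integers with $b_i>0$ if $1\leq i\leq 2m$. Similarly, $\begin{pmatrix} u\\ v\end{pmatrix}\in\Psi_1\begin{pmatrix} x\\ y\end{pmatrix}$ if and only if the even continued fraction of $\frac{u}{v}$ has the form \[ \frac{u}{v}= [b_0;4b_1, b_2, 4b_3,\ldots, b_{2m}, 4b_{2m+1} + a_1, a_2, \ldots, a_{2n-1}], \] where the $b_i$ are nonnegative integers with $b_i>0$ if $1\leq i\leq 2m$.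
   Context: $\Psi_1=\left\langle\begin{pmatrix} 1 & 1\\ 0 & 1\end{pmatrix},\begin{pmatrix} 1 & 0\\ 4 & 1\end{pmatrix}\right\rangle^+$ and $\Psi_2=\left\langle\begin{pmatrix} 1 & 4\\ 0 & 1\end{pmatrix},\begin{pmatrix} 1 & 0\\ 4 & 1\end{pmatrix}\right\rangle^+$, where $\langle\cdots\rangle^+$ denotes the monoid generated (including the identity). The even continued fraction of a rational number is its unique continued fraction expansion $[a_0;a_1,\ldots,a_k]$ with $k$ odd (an even number of partial quotients after $a_0$). -}

module Defs where

open import Data.Nat using (ℕ; zero; suc; _+_; _*_; _≤_; _<_)
open import Data.Nat.Base using (_%_)
open import Data.Product using (_×_; _,_; Σ; ∃; proj₁; proj₂)
open import Data.List using (List; []; _∷_; length; map; upTo; _++_)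
open import Data.List.Relation.Unary.All using (All)
open import Relation.Binary.PropositionalEquality using (_≡_)

record Mat : Set where
  constructor mat
  field
    m₁₁ m₁₂ m₂₁ m₂₂ : ℕ
open Mat public

_⊗_ : Mat → Mat → Mat
mat a b c d ⊗ mat e f g h = mat (a * e + b * g) (a * f + b * h) (c * e + d * g) (c * f + d * h)

idMat : Mat
idMat = mat 1 0 0 1

Vec2 : Set
Vec2 = ℕ × ℕ

_·_ : Mat → Vec2 → Vec2
mat a b c d · (x , y) = (a * x + b * y , c * x + d * y)

data Ψ₁ : Mat → Set where
  ψ₁-id : Ψ₁ idMat
  ψ₁-R  : ∀ {M} → Ψ₁ M → Ψ₁ (M ⊗ mat 1 1 0 1)
  ψ₁-L  : ∀ {M} → Ψ₁ M → Ψ₁ (M ⊗ mat 1 0 4 1)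

data Ψ₂ : Mat → Set where
  ψ₂-id : Ψ₂ idMat
  ψ₂-R  : ∀ {M} → Ψ₂ M → Ψ₂ (M ⊗ mat 1 4 0 1)
  ψ₂-L  : ∀ {M} → Ψ₂ M → Ψ₂ (M ⊗ mat 1 0 4 1)

_∈_[_] : Vec2 → (Mat → Set) → Vec2 → Set
w ∈ Ψ [ z ] = Σ Mat λ M → Ψ M × (M · z ≡ w)

cfVal : ℕ → List ℕ → ℕ × ℕ
cfVal a [] = (a , 1)
cfVal a (b ∷ l) with cfVal b l
... | (p , q) = (a * p + q , p)

-- [a₀; as] is the even continued fraction of u/v:
-- a₀ ∈ ℕ, all later partial quotients ≥ 1, k = length as is odd,
-- and u/v = p/q (written as u * q ≡ v * p; q ≥ 1 always).
IsEvenCF : ℕ → ℕ → ℕ → List ℕ → Set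
IsEvenCF u v a₀ as =
  (∃ λ j → length as ≡ suc (2 * j)) ×
  All (1 ≤_) as ×
  (u * proj₂ (cfVal a₀ as) ≡ v * proj₁ (cfVal a₀ as))

mid : ℕ → List ℕ
mid m = map suc (upTo (2 * m))

coef₂ : ℕ → ℕ
coef₂ i = 4

coef₁ : ℕ → ℕ
coef₁ i with i % 2
... | 0 = 1
... | _ = 4

formTail : (ℕ → ℕ) → ℕ → (ℕ → ℕ) → ℕ → List ℕ → List ℕ
formTail c m b a₁ as = map (λ i → c i * b i) (mid m) ++ ((4 * b (suc (2 * m)) + a₁) ∷ as)

PosMid : ℕ → (ℕ → ℕ) → Set
PosMid m b = ∀ i → 1 ≤ i → i ≤ 2 * m → 0 < b i

{-# OPTIONS --safe #-}
module Submission where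

-- With R n = (1 n ; 0 1) and L n = (1 0 ; n 1), Ψ₂ and Ψ₁ are the monoids generated by R k and
-- L 4 for k = 4 and k = 1. Building an element letter by letter from the left shows that it is a
-- word R k ^ b₀ L 4 ^ b₁ ⋯ R k ^ b₂ₘ L 4 ^ b₂ₘ₊₁ with positive interior exponents: R k raises b₀,
-- and L 4 raises b₁ when b₀ = 0 and otherwise opens a new block with exponents (0 , 1).
-- Conversely every such word lies in the monoid. On vectors of continued fractions R n adds n to
-- the leading partial quotient, while L s turns [t; l] into [0; s, t, l] and adds s to the first
-- quotient after a leading 0, so the word sends (x , y) = [0; a₁, a₂, …] to
-- [k b₀; 4 b₁, k b₂, …, 4 b₂ₘ₊₁ + a₁, a₂, …]. Values of continued fractions are coprime pairs, so
-- for coprime (u , v) the equation u/v = [⋯] is an equality of vectors.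

open import Defs
open import Algebra.Core using (Op₂)
open import Algebra.Structures using (IsMonoid)
open import Data.Nat using (ℕ; zero; suc; _+_; _*_; _≤_; _<_; z≤n; s≤s; z<s; _≟_)
open import Data.Nat.Properties
open import Data.Nat.Coprimality using (Coprime; coprime-divisor) renaming (sym to coprime-sym)
open import Data.Nat.Divisibility using (_∣_; ∣1⇒≡1; ∣-antisym; ∣m+n∣m⇒∣n; n∣m*n; m∣m*n; ∣-trans)
open import Data.Nat.Tactic.RingSolver using (solve-∀)
open import Data.Product using (_×_; _,_; Σ; ∃; proj₁; proj₂; swap)
open import Data.List using (List; []; _∷_; map; _++_; length; upTo; applyUpTo)
open import Data.List.Properties using (map-∘; map-cong; map-upTo; length-++; length-map; length-upTo)
open import Data.List.Relation.Unary.All using (All; _∷_)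
open import Data.List.Relation.Unary.All.Properties using (++⁺; map⁺; applyUpTo⁺₁)
open import Function.Base using (_∘_; id)
open import Function.Bundles using (_⇔_; mk⇔; Equivalence)
open import Function.Construct.Composition using (_⇔-∘_)
open import Relation.Binary.PropositionalEquality
open import Relation.Nullary using (yes; no)
open ≡-Reasoning

infixr 5 _◂_

_◂_ : ℕ → (ℕ → ℕ) → ℕ → ℕ
(e ◂ b) zero    = e
(e ◂ b) (suc i) = b i

PosMid-zero : ∀ b → PosMid 0 b
PosMid-zero b zero    () _
PosMid-zero b (suc i) _  ()

PosMid-◂ : ∀ {m b e} → PosMid m b → PosMid m (e ◂ b ∘ suc)
PosMid-◂ pos zero    ()
PosMid-◂ pos (suc i) = pos (suc i)

PosMid-◂◂ : ∀ {m b e f} → 0 < f → PosMid m b → PosMid m (e ◂ f ◂ b ∘ suc ∘ suc)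
PosMid-◂◂ f>0 pos zero          ()
PosMid-◂◂ f>0 pos (suc zero)    _ _ = f>0
PosMid-◂◂ f>0 pos (suc (suc i)) = pos (suc (suc i))

PosMid-prepend : ∀ {m b e f} → 0 < f → 0 < b 0 → PosMid m b → PosMid (suc m) (e ◂ f ◂ b)
PosMid-prepend f>0 b₀>0 pos zero                ()
PosMid-prepend f>0 b₀>0 pos (suc zero)          _ _ = f>0
PosMid-prepend f>0 b₀>0 pos (suc (suc zero))    _ _ = b₀>0
PosMid-prepend {m} f>0 b₀>0 pos (suc (suc (suc i))) _ i≤ =
  pos (suc i) (s≤s z≤n) (≤-pred (≤-pred (subst (3 + i ≤_) (*-suc 2 m) i≤)))

module MonoidWords {A : Set} {_∙_ : Op₂ A} {ε : A} (isMonoid : IsMonoid _≡_ _∙_ ε) (r s : A) where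

  open IsMonoid isMonoid using (assoc; identityˡ; identityʳ)

  infixr 30 _^_

  _^_ : A → ℕ → A
  x ^ zero  = ε
  x ^ suc n = x ∙ x ^ n

  data Generated : A → Set where
    gen-ε : Generated ε
    gen-r : ∀ {M} → Generated M → Generated (M ∙ r)
    gen-s : ∀ {M} → Generated M → Generated (M ∙ s)

  block : ℕ → ℕ → A → A
  block e f N = r ^ e ∙ (s ^ f ∙ N)

  -- word m b = r ^ b 0 ∙ s ^ b 1 ∙ r ^ b 2 ∙ ⋯ ∙ r ^ b (2m) ∙ s ^ b (2m+1)
  word : ℕ → (ℕ → ℕ) → A
  laterBlocks : ℕ → (ℕ → ℕ) → A

  word m b = block (b 0) (b 1) (laterBlocks m (λ i → b (2 + i)))

  laterBlocks zero    _ = ε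
  laterBlocks (suc m) b = word m b

  IsWord : A → Set
  IsWord M = Σ ℕ λ m → Σ (ℕ → ℕ) λ b → PosMid m b × word m b ≡ M

  r∙block : ∀ e f N → r ∙ block e f N ≡ block (suc e) f N
  r∙block e f N = sym (assoc r (r ^ e) (s ^ f ∙ N))

  s∙block : ∀ {e} f N → e ≡ 0 → s ∙ block e f N ≡ block e (suc f) N
  s∙block f N refl = begin
    s ∙ (ε ∙ (s ^ f ∙ N))   ≡⟨ cong (s ∙_) (identityˡ _) ⟩
    s ∙ (s ^ f ∙ N)         ≡⟨ assoc s (s ^ f) N ⟨
    s ^ suc f ∙ N           ≡⟨ identityˡ _ ⟨
    ε ∙ (s ^ suc f ∙ N)     ∎

  s∙ : ∀ N → s ∙ N ≡ block 0 1 N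
  s∙ N = begin
    s ∙ N             ≡⟨ cong (_∙ N) (identityʳ s) ⟨
    s ^ 1 ∙ N         ≡⟨ identityˡ _ ⟨
    ε ∙ (s ^ 1 ∙ N)   ∎

  IsWord-ε : IsWord ε
  IsWord-ε = 0 , (λ _ → 0) , PosMid-zero _ , trans (identityˡ _) (identityˡ ε)

  IsWord-r∙ : ∀ {N} → IsWord N → IsWord (r ∙ N)
  IsWord-r∙ (m , b , pos , refl) =
    m , suc (b 0) ◂ b ∘ suc , PosMid-◂ {m} pos ,
    sym (r∙block (b 0) (b 1) (laterBlocks m (λ i → b (2 + i))))

  IsWord-s∙ : ∀ {N} → IsWord N → IsWord (s ∙ N)
  IsWord-s∙ (m , b , pos , refl) with b 0 ≟ 0
  ... | yes b₀≡0 = m , b 0 ◂ suc (b 1) ◂ b ∘ suc ∘ suc , PosMid-◂◂ {m} z<s pos ,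
                   sym (s∙block (b 1) (laterBlocks m (λ i → b (2 + i))) b₀≡0)
  ... | no b₀≢0  = suc m , 0 ◂ 1 ◂ b , PosMid-prepend z<s (n≢0⇒n>0 b₀≢0) pos ,
                   sym (s∙ (word m b))

  -- Generated appends letters on the right while words absorb them on the left; quantifying over N
  -- reconciles the two.
  IsWord-∙ : ∀ {M N} → Generated M → IsWord N → IsWord (M ∙ N)
  IsWord-∙ {N = N} gen-ε         w = subst IsWord (sym (identityˡ N)) w
  IsWord-∙ {N = N} (gen-r {M} g) w = subst IsWord (sym (assoc M r N)) (IsWord-∙ g (IsWord-r∙ w))
  IsWord-∙ {N = N} (gen-s {M} g) w = subst IsWord (sym (assoc M s N)) (IsWord-∙ g (IsWord-s∙ w))

  Generated⇒IsWord : ∀ {M} → Generated M → IsWord M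
  Generated⇒IsWord {M} g = subst IsWord (identityʳ M) (IsWord-∙ g IsWord-ε)

  Generated-∙ : ∀ {M N} → Generated M → Generated N → Generated (M ∙ N)
  Generated-∙ {M} g gen-ε         = subst Generated (sym (identityʳ M)) g
  Generated-∙ {M} g (gen-r {N} h) = subst Generated (assoc M N r) (gen-r (Generated-∙ g h))
  Generated-∙ {M} g (gen-s {N} h) = subst Generated (assoc M N s) (gen-s (Generated-∙ g h))

  Generated-^ : ∀ {x} → Generated x → ∀ n → Generated (x ^ n)
  Generated-^ g zero    = gen-ε
  Generated-^ g (suc n) = Generated-∙ g (Generated-^ g n)

  Generated-r : Generated r
  Generated-r = subst Generated (identityˡ r) (gen-r gen-ε)

  Generated-s : Generated s
  Generated-s = subst Generated (identityˡ s) (gen-s gen-ε)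

  Generated-block : ∀ e f {N} → Generated N → Generated (block e f N)
  Generated-block e f g = Generated-∙ (Generated-^ Generated-r e) (Generated-∙ (Generated-^ Generated-s f) g)

  Generated-word : ∀ m b → Generated (word m b)
  Generated-word zero    b = Generated-block (b 0) (b 1) gen-ε
  Generated-word (suc m) b = Generated-block (b 0) (b 1) (Generated-word m (λ i → b (2 + i)))

mat-cong : ∀ {a b c d a′ b′ c′ d′} → a ≡ a′ → b ≡ b′ → c ≡ c′ → d ≡ d′ →
           mat a b c d ≡ mat a′ b′ c′ d′
mat-cong refl refl refl refl = refl

⊗-entry-assoc : ∀ a b e f g h x y →
  (a * e + b * g) * x + (a * f + b * h) * y ≡ a * (e * x + f * y) + b * (g * x + h * y)
⊗-entry-assoc = solve-∀

⊗-assoc : ∀ A B C → (A ⊗ B) ⊗ C ≡ A ⊗ (B ⊗ C)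
⊗-assoc (mat a b c d) (mat e f g h) (mat i j k l) =
  mat-cong (⊗-entry-assoc a b e f g h i k) (⊗-entry-assoc a b e f g h j l)
           (⊗-entry-assoc c d e f g h i k) (⊗-entry-assoc c d e f g h j l)

⊗-· : ∀ A B z → (A ⊗ B) · z ≡ A · (B · z)
⊗-· (mat a b c d) (mat e f g h) (x , y) =
  cong₂ _,_ (⊗-entry-assoc a b e f g h x y) (⊗-entry-assoc c d e f g h x y)

1*m+0*n≡m : ∀ m n → 1 * m + 0 * n ≡ m
1*m+0*n≡m = solve-∀

m*1+n*0≡m : ∀ m n → m * 1 + n * 0 ≡ m
m*1+n*0≡m = solve-∀

m*0+n*1≡n : ∀ m n → m * 0 + n * 1 ≡ n
m*0+n*1≡n = solve-∀

⊗-identityˡ : ∀ A → idMat ⊗ A ≡ A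
⊗-identityˡ (mat a b c d) =
  mat-cong (1*m+0*n≡m a c) (1*m+0*n≡m b d) (+-identityʳ c) (+-identityʳ d)

⊗-identityʳ : ∀ A → A ⊗ idMat ≡ A
⊗-identityʳ (mat a b c d) =
  mat-cong (m*1+n*0≡m a b) (m*0+n*1≡n a b) (m*1+n*0≡m c d) (m*0+n*1≡n c d)

·-identityˡ : ∀ z → idMat · z ≡ z
·-identityˡ (x , y) = cong₂ _,_ (1*m+0*n≡m x y) (+-identityʳ y)

⊗-isMonoid : IsMonoid _≡_ _⊗_ idMat
⊗-isMonoid = record
  { isSemigroup = record
    { isMagma = record { isEquivalence = isEquivalence ; ∙-cong = cong₂ _⊗_ }
    ; assoc   = ⊗-assoc
    }
  ; identity = ⊗-identityˡ , ⊗-identityʳ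
  }

R : ℕ → Mat
R n = mat 1 n 0 1

L : ℕ → Mat
L n = mat 1 0 n 1

R-⊗ : ∀ m n → R m ⊗ R n ≡ R (m + n)
R-⊗ m n = mat-cong (m*1+n*0≡m 1 m) (trans (+-comm (1 * n) (m * 1)) (cong₂ _+_ (*-identityʳ m) (*-identityˡ n)))
                   refl refl

L-⊗ : ∀ m n → L m ⊗ L n ≡ L (m + n)
L-⊗ m n = mat-cong refl refl (cong₂ _+_ (*-identityʳ m) (*-identityˡ n)) (m*0+n*1≡n m 1)

R-· : ∀ n p q → R n · (p , q) ≡ (p + n * q , q)
R-· n p q = cong₂ _,_ (cong (_+ n * q) (*-identityˡ p)) (*-identityˡ q)

L-· : ∀ n p q → L n · (p , q) ≡ (p , n * p + q)
L-· n p q = cong₂ _,_ (1*m+0*n≡m p q) (cong (n * p +_) (*-identityˡ q))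

cfVal-0∷ : ∀ t l → cfVal 0 (t ∷ l) ≡ swap (cfVal t l)
cfVal-0∷ t l with cfVal t l
... | (p , q) = refl

cfVal-+ : ∀ m n l → cfVal (m + n) l ≡ R m · cfVal n l
cfVal-+ m n [] =
  trans (cong (_, 1) (trans (+-comm m n) (cong (n +_) (sym (*-identityʳ m))))) (sym (R-· m n 1))
cfVal-+ m n (s ∷ l) with cfVal s l
... | (p , q) = trans (cong (_, p) (shift m n p q)) (sym (R-· m (n * p + q) p))
  where
  shift : ∀ m n p q → (m + n) * p + q ≡ n * p + q + m * p
  shift = solve-∀

cfVal-head : ∀ a l → cfVal a l ≡ R a · cfVal 0 l
cfVal-head a l = trans (cong (λ n → cfVal n l) (sym (+-identityʳ a))) (cfVal-+ a 0 l)

cfVal-0∷-+ : ∀ n t l → cfVal 0 (n + t ∷ l) ≡ L n · cfVal 0 (t ∷ l)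
cfVal-0∷-+ n t l = begin
  cfVal 0 (n + t ∷ l)        ≡⟨ cfVal-0∷ (n + t) l ⟩
  swap (cfVal (n + t) l)     ≡⟨ cong swap (cfVal-+ n t l) ⟩
  swap (R n · cfVal t l)     ≡⟨ R-swap (cfVal t l) ⟩
  L n · swap (cfVal t l)     ≡⟨ cong (L n ·_) (cfVal-0∷ t l) ⟨
  L n · cfVal 0 (t ∷ l)      ∎
  where
  R-swap : ∀ z → swap (R n · z) ≡ L n · swap z
  R-swap (p , q) =
    trans (cong swap (R-· n p q)) (trans (cong (q ,_) (+-comm p (n * q))) (sym (L-· n q p)))

cfVal-0∷∷ : ∀ s t l → cfVal 0 (s ∷ t ∷ l) ≡ L s · cfVal t l
cfVal-0∷∷ s t l with cfVal t l
... | (p , q) = sym (L-· s p q)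

cfVal-coprime : ∀ a l → Coprime (proj₁ (cfVal a l)) (proj₂ (cfVal a l))
cfVal-coprime a []      (_ , d∣1) = ∣1⇒≡1 d∣1
cfVal-coprime a (s ∷ l) with cfVal s l | cfVal-coprime s l
... | (p , q) | p⊥q = λ (d∣ap+q , d∣p) → p⊥q (d∣p , ∣m+n∣m⇒∣n d∣ap+q (∣-trans d∣p (n∣m*n a)))

coprime-∣-cross : ∀ {u v p q} → Coprime u v → u * q ≡ v * p → u ∣ p
coprime-∣-cross {u} {q = q} u⊥v uq≡vp = coprime-divisor u⊥v (subst (u ∣_) uq≡vp (m∣m*n q))

coprime-cross-≡ : ∀ {u v p q} → Coprime u v → Coprime p q → u * q ≡ v * p → (u , v) ≡ (p , q)
coprime-cross-≡ {u} {v} {p} {q} u⊥v p⊥q uq≡vp = cong₂ _,_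
  (∣-antisym (coprime-∣-cross u⊥v uq≡vp) (coprime-∣-cross p⊥q pv≡qu))
  (∣-antisym (coprime-∣-cross (coprime-sym u⊥v) (sym uq≡vp))
             (coprime-∣-cross (coprime-sym p⊥q) (sym pv≡qu)))
  where
  pv≡qu : p * v ≡ q * u
  pv≡qu = trans (*-comm p v) (trans (sym uq≡vp) (*-comm u q))

IsEvenCF⇒cfVal≡ : ∀ {u v a T} → Coprime u v → IsEvenCF u v a T → cfVal a T ≡ (u , v)
IsEvenCF⇒cfVal≡ {a = a} {T} u⊥v (_ , _ , cross) =
  sym (coprime-cross-≡ u⊥v (cfVal-coprime a T) cross)

cfVal≡⇒IsEvenCF : ∀ {u v a T} → (∃ λ j → length T ≡ suc (2 * j)) → All (1 ≤_) T →
                  cfVal a T ≡ (u , v) → IsEvenCF u v a T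
cfVal≡⇒IsEvenCF {u} {v} odd pos cfVal≡ =
  odd , pos , subst (λ w → u * proj₂ w ≡ v * proj₁ w) (sym cfVal≡) (*-comm u v)

mid-suc : ∀ m → mid (suc m) ≡ 1 ∷ 2 ∷ map (2 +_) (mid m)
mid-suc m = begin
  map suc (upTo (2 * suc m))
    ≡⟨ cong (map suc ∘ upTo) (*-suc 2 m) ⟩
  1 ∷ 2 ∷ map suc (applyUpTo (suc ∘ suc) (2 * m))
    ≡⟨ cong (λ l → 1 ∷ 2 ∷ map suc l) (map-upTo (suc ∘ suc) (2 * m)) ⟨
  1 ∷ 2 ∷ map suc (map (suc ∘ suc) (upTo (2 * m)))
    ≡⟨ cong (λ l → 1 ∷ 2 ∷ l) (map-∘ (upTo (2 * m))) ⟨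
  1 ∷ 2 ∷ map (suc ∘ suc ∘ suc) (upTo (2 * m))
    ≡⟨ cong (λ l → 1 ∷ 2 ∷ l) (map-∘ (upTo (2 * m))) ⟩
  1 ∷ 2 ∷ map (2 +_) (mid m)
    ∎

length-mid : ∀ m → length (mid m) ≡ 2 * m
length-mid m = trans (length-map suc (upTo (2 * m))) (length-upTo (2 * m))

formTail-odd : ∀ c m b {a as} → (∃ λ j → length (a ∷ as) ≡ suc (2 * j)) →
               ∃ λ j → length (formTail c m b a as) ≡ suc (2 * j)
formTail-odd c m b {a} {as} (j , len) = m + j , (begin
  length (formTail c m b a as)
    ≡⟨ length-++ (map (λ i → c i * b i) (mid m)) ⟩
  length (map (λ i → c i * b i) (mid m)) + suc (length as)
    ≡⟨ cong₂ _+_ (trans (length-map _ (mid m)) (length-mid m)) len ⟩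
  2 * m + suc (2 * j)
    ≡⟨ +-suc (2 * m) (2 * j) ⟩
  suc (2 * m + 2 * j)
    ≡⟨ cong suc (*-distribˡ-+ 2 m j) ⟨
  suc (2 * (m + j))
    ∎)

formTail-positive : ∀ c m b {a as} → (∀ i → 0 < c (suc i)) → PosMid m b →
                    All (1 ≤_) (a ∷ as) → All (1 ≤_) (formTail c m b a as)
formTail-positive c m b c-pos pos (a-pos ∷ as-pos) =
  ++⁺ (map⁺ (map⁺ (applyUpTo⁺₁ id (2 * m) λ {i} i<2m →
         *-mono-≤ (c-pos i) (pos (suc i) (s≤s z≤n) i<2m))))
      (≤-trans a-pos (m≤n+m _ _) ∷ as-pos)

-- lead (b 0) is the leading partial quotient: the orbit lemma produces k * b 0, while the Ψ₁ part
-- of the theorem is stated with b 0.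
HasEvenCFForm : (ℕ → ℕ) → (ℕ → ℕ) → ℕ → List ℕ → ℕ → ℕ → Set
HasEvenCFForm lead c a₁ as u v =
  Σ ℕ λ m → Σ (ℕ → ℕ) λ b → PosMid m b × IsEvenCF u v (lead (b 0)) (formTail c m b a₁ as)

HasEvenCFForm-cong : ∀ {f g c a₁ as u v} → f ≗ g →
                     HasEvenCFForm f c a₁ as u v ⇔ HasEvenCFForm g c a₁ as u v
HasEvenCFForm-cong {c = c} {a₁} {as} {u} {v} f≗g = mk⇔ (relead f≗g) (relead (sym ∘ f≗g))
  where
  relead : ∀ {f g} → f ≗ g → HasEvenCFForm f c a₁ as u v → HasEvenCFForm g c a₁ as u v
  relead f≗g (m , b , pos , cf) =
    m , b , pos , subst (λ a → IsEvenCF u v a (formTail c m b a₁ as)) (f≗g (b 0)) cf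

module Orbit (k : ℕ) where

  open MonoidWords ⊗-isMonoid (R k) (L 4)

  R-^ : ∀ n e → R n ^ e ≡ R (n * e)
  R-^ n zero    = cong R (sym (*-zeroʳ n))
  R-^ n (suc e) = trans (cong (R n ⊗_) (R-^ n e)) (trans (R-⊗ n (n * e)) (cong R (sym (*-suc n e))))

  L-^ : ∀ n e → L n ^ e ≡ L (n * e)
  L-^ n zero    = cong L (sym (*-zeroʳ n))
  L-^ n (suc e) = trans (cong (L n ⊗_) (L-^ n e)) (trans (L-⊗ n (n * e)) (cong L (sym (*-suc n e))))

  block-· : ∀ e f N z → block e f N · z ≡ R (k * e) · (L (4 * f) · (N · z))
  block-· e f N z = begin
    (R k ^ e ⊗ (L 4 ^ f ⊗ N)) · z       ≡⟨ ⊗-· (R k ^ e) _ z ⟩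
    R k ^ e · ((L 4 ^ f ⊗ N) · z)       ≡⟨ cong (R k ^ e ·_) (⊗-· (L 4 ^ f) N z) ⟩
    R k ^ e · (L 4 ^ f · (N · z))       ≡⟨ cong₂ (λ A B → A · (B · (N · z))) (R-^ k e) (L-^ 4 f) ⟩
    R (k * e) · (L (4 * f) · (N · z))   ∎

  module _ (c : ℕ → ℕ) (c₀ : c 0 ≡ k) (c₁ : c 1 ≡ 4) (c-periodic : ∀ i → c (2 + i) ≡ c i)
           (k>0 : 0 < k) where

    c-pos : ∀ i → 0 < c i
    c-pos zero          = subst (0 <_) (sym c₀) k>0
    c-pos (suc zero)    = subst (0 <_) (sym c₁) z<s
    c-pos (suc (suc i)) = subst (0 <_) (sym (c-periodic i)) (c-pos i)

    formTail-suc : ∀ m b a as →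
      formTail c (suc m) b a as ≡ 4 * b 1 ∷ k * b 2 ∷ formTail c m (λ i → b (2 + i)) a as
    formTail-suc m b a as = begin
      map cb (mid (suc m)) ++ (4 * b (suc (2 * suc m)) + a) ∷ as
        ≡⟨ cong₂ (λ l n → map cb l ++ (4 * b (suc n) + a) ∷ as) (mid-suc m) (*-suc 2 m) ⟩
      c 1 * b 1 ∷ c 2 * b 2 ∷ map cb (map (2 +_) (mid m)) ++ last
        ≡⟨ cong₂ (λ x y → x * b 1 ∷ y * b 2 ∷ map cb (map (2 +_) (mid m)) ++ last)
                 c₁ (trans (c-periodic 0) c₀) ⟩
      4 * b 1 ∷ k * b 2 ∷ map cb (map (2 +_) (mid m)) ++ last
        ≡⟨ cong (λ l → 4 * b 1 ∷ k * b 2 ∷ l ++ last) (map-∘ (mid m)) ⟨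
      4 * b 1 ∷ k * b 2 ∷ map (cb ∘ (2 +_)) (mid m) ++ last
        ≡⟨ cong (λ l → 4 * b 1 ∷ k * b 2 ∷ l ++ last)
                (map-cong (λ i → cong (_* b (2 + i)) (c-periodic i)) (mid m)) ⟩
      4 * b 1 ∷ k * b 2 ∷ formTail c m (λ i → b (2 + i)) a as ∎
      where
      cb : ℕ → ℕ
      cb i = c i * b i
      last : List ℕ
      last = (4 * b (3 + 2 * m) + a) ∷ as

    word-· : ∀ m b a as → word m b · cfVal 0 (a ∷ as) ≡ cfVal (k * b 0) (formTail c m b a as)
    word-· zero b a as = begin
      word zero b · cfVal 0 (a ∷ as)
        ≡⟨ block-· (b 0) (b 1) idMat _ ⟩
      R (k * b 0) · (L (4 * b 1) · (idMat · cfVal 0 (a ∷ as)))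
        ≡⟨ cong (λ z → R (k * b 0) · (L (4 * b 1) · z)) (·-identityˡ _) ⟩
      R (k * b 0) · (L (4 * b 1) · cfVal 0 (a ∷ as))
        ≡⟨ cong (R (k * b 0) ·_) (cfVal-0∷-+ (4 * b 1) a as) ⟨
      R (k * b 0) · cfVal 0 ((4 * b 1 + a) ∷ as)
        ≡⟨ cfVal-head (k * b 0) ((4 * b 1 + a) ∷ as) ⟨
      cfVal (k * b 0) ((4 * b 1 + a) ∷ as)
        ∎
    word-· (suc m) b a as = begin
      word (suc m) b · cfVal 0 (a ∷ as)
        ≡⟨ block-· (b 0) (b 1) (word m b′) _ ⟩
      R (k * b 0) · (L (4 * b 1) · (word m b′ · cfVal 0 (a ∷ as)))
        ≡⟨ cong (λ z → R (k * b 0) · (L (4 * b 1) · z)) (word-· m b′ a as) ⟩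
      R (k * b 0) · (L (4 * b 1) · cfVal (k * b 2) T)
        ≡⟨ cong (R (k * b 0) ·_) (cfVal-0∷∷ (4 * b 1) (k * b 2) T) ⟨
      R (k * b 0) · cfVal 0 (4 * b 1 ∷ k * b 2 ∷ T)
        ≡⟨ cfVal-head (k * b 0) (4 * b 1 ∷ k * b 2 ∷ T) ⟨
      cfVal (k * b 0) (4 * b 1 ∷ k * b 2 ∷ T)
        ≡⟨ cong (cfVal (k * b 0)) (formTail-suc m b a as) ⟨
      cfVal (k * b 0) (formTail c (suc m) b a as)
        ∎
      where
      b′ : ℕ → ℕ
      b′ i = b (2 + i)
      T : List ℕ
      T = formTail c m b′ a as

    orbit : ∀ {x y a₁ as u v} → Coprime x y → IsEvenCF x y 0 (a₁ ∷ as) → Coprime u v →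
            (u , v) ∈ Generated [ (x , y) ] ⇔ HasEvenCFForm (k *_) c a₁ as u v
    orbit {x} {y} {a₁} {as} {u} {v} x⊥y xy-cf@(xy-odd , xy-pos , _) u⊥v = mk⇔ to from
      where
      word-·xy : ∀ m b → word m b · (x , y) ≡ cfVal (k * b 0) (formTail c m b a₁ as)
      word-·xy m b =
        trans (cong (word m b ·_) (sym (IsEvenCF⇒cfVal≡ {a = 0} x⊥y xy-cf))) (word-· m b a₁ as)

      to : (u , v) ∈ Generated [ (x , y) ] → HasEvenCFForm (k *_) c a₁ as u v
      to (M , g , M·xy≡uv) =
        let (m , b , pos , word≡M) = Generated⇒IsWord g in
        m , b , pos ,
        cfVal≡⇒IsEvenCF (formTail-odd c m b xy-odd) (formTail-positive c m b (c-pos ∘ suc) pos xy-pos)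
          (trans (sym (word-·xy m b)) (trans (cong (_· (x , y)) word≡M) M·xy≡uv))

      from : HasEvenCFForm (k *_) c a₁ as u v → (u , v) ∈ Generated [ (x , y) ]
      from (m , b , _ , uv-cf) =
        word m b , Generated-word m b , trans (word-·xy m b) (IsEvenCF⇒cfVal≡ u⊥v uv-cf)

∈-⇔ : ∀ {Ψ Φ : Mat → Set} {w z} → (∀ {M} → Ψ M ⇔ Φ M) → w ∈ Ψ [ z ] ⇔ w ∈ Φ [ z ]
∈-⇔ Ψ⇔Φ = mk⇔ (λ (M , ψ , e) → M , Equivalence.to Ψ⇔Φ ψ , e)
               (λ (M , φ , e) → M , Equivalence.from Ψ⇔Φ φ , e)

Ψ₂⇔Generated : ∀ {M} → Ψ₂ M ⇔ MonoidWords.Generated ⊗-isMonoid (R 4) (L 4) M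
Ψ₂⇔Generated = mk⇔ to from
  where
  open MonoidWords ⊗-isMonoid (R 4) (L 4)
  to : ∀ {M} → Ψ₂ M → Generated M
  to ψ₂-id    = gen-ε
  to (ψ₂-R ψ) = gen-r (to ψ)
  to (ψ₂-L ψ) = gen-s (to ψ)
  from : ∀ {M} → Generated M → Ψ₂ M
  from gen-ε     = ψ₂-id
  from (gen-r g) = ψ₂-R (from g)
  from (gen-s g) = ψ₂-L (from g)

Ψ₁⇔Generated : ∀ {M} → Ψ₁ M ⇔ MonoidWords.Generated ⊗-isMonoid (R 1) (L 4) M
Ψ₁⇔Generated = mk⇔ to from
  where
  open MonoidWords ⊗-isMonoid (R 1) (L 4)
  to : ∀ {M} → Ψ₁ M → Generated M
  to ψ₁-id    = gen-ε
  to (ψ₁-R ψ) = gen-r (to ψ)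
  to (ψ₁-L ψ) = gen-s (to ψ)
  from : ∀ {M} → Generated M → Ψ₁ M
  from gen-ε     = ψ₁-id
  from (gen-r g) = ψ₁-R (from g)
  from (gen-s g) = ψ₁-L (from g)

proposition2p15 : (x y : ℕ) → x < y → Coprime x y →
    (a₁ : ℕ) (as : List ℕ) → IsEvenCF x y 0 (a₁ ∷ as) →
    (u v : ℕ) → Coprime u v →
      ((u , v) ∈ Ψ₂ [ (x , y) ] ⇔
        Σ ℕ λ m → Σ (ℕ → ℕ) λ b → PosMid m b ×
          IsEvenCF u v (4 * b 0) (formTail coef₂ m b a₁ as))
      ×
      ((u , v) ∈ Ψ₁ [ (x , y) ] ⇔
        Σ ℕ λ m → Σ (ℕ → ℕ) λ b → PosMid m b ×
          IsEvenCF u v (b 0) (formTail coef₁ m b a₁ as))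
proposition2p15 x y _ x⊥y a₁ as xy-cf u v u⊥v =
    Orbit.orbit 4 coef₂ refl refl (λ _ → refl) z<s x⊥y xy-cf u⊥v ⇔-∘ ∈-⇔ Ψ₂⇔Generated
  , HasEvenCFForm-cong {c = coef₁} {u = u} {v = v} *-identityˡ
      ⇔-∘ (Orbit.orbit 1 coef₁ refl refl (λ _ → refl) z<s x⊥y xy-cf u⊥v ⇔-∘ ∈-⇔ Ψ₁⇔Generated)
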